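{- Let $G$ and $H$ be regular graphs that are Ricci flat (at every vertex). Then the tensor product $G\otimes H$, the Cartesian product $G\times H$ and the strong product $G\boxtimes H$ are Ricci flat. Likewise, if $G$ and $H$ are both $(R)$-Ricci flat (resp. $(S)$-Ricci flat, resp. $(RS)$-Ricci flat), then so are $G\otimes H$, $G\times H$ and $G\boxtimes H$.
   Context: Graphs are simple, undirected, with finite degrees. For a $d$-regular graph $\Gamma=(V,E)$, a vertex $x$ is Ricci flat if there exist maps $\eta_1,\dots,\eta_d:B_1(x)\to V$ ($B_1(x)$ the closed 1-ball) with (i) $\eta_i(u)\sim u$ for all $u\in B_1(x)$; (ii) $\eta_i(u)\ne\eta_j(u)$ for $i\ne j$; (iii) $\bigcup_j\eta_j(\eta_ix)=\bigcup_j\eta_i(\eta_jx)$ for all $i$. It is $(R)$-Ricci flat if such maps exist with additionally $\eta_i(\eta_ix)=x$ for all $i$; $(S)$-Ricci flat if such maps exist with additionally $\eta_j(\eta_ix)=\eta_i(\eta_jx)$ for all $i,j$; $(RS)$-Ricci flat if such maps satisfy both. A graph has one of these properties if all its vertices do. Products of $G=(V_G,E_G)$ and $H=(V_H,E_H)$ have vertex set $V_G\times V_H$; horizontal edges are $\{(x_1,y),(x_2,y)\}$ with $x_1\sim x_2$ in $G$, vertical edges $\{(x,y_1),(x,y_2)\}$ with $y_1\sim y_2$ in $H$, diagonal edges $\{(x_1,y_1),(x_2,y_2)\}$ with $x_1\sim x_2$ and $y_1\sim y_2$. $G\otimes H$ has the diagonal edges, $G\times H$ the horizontal and vertical edges,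 $G\boxtimes H$ all three types. If $G$ is $d_G$-regular and $H$ is $d_H$-regular these products are $d_Gd_H$-, $(d_G+d_H)$- and $(d_G+d_H+d_Gd_H)$-regular respectively. -}

module Defs where

open import Data.Nat using (ℕ; _+_; _*_)
open import Data.Fin using (Fin)
open import Data.Product using (Σ; _×_; _,_; ∃-syntax)
open import Data.Sum using (_⊎_; inj₁; inj₂)
open import Relation.Nullary using (¬_)
open import Data.Unit using (⊤)
open import Relation.Binary.PropositionalEquality using (_≡_; _≢_; sym)
open import Function.Bundles using (_⇔_)

record Graph : Set₁ where
  field
    V       : Set
    _~_     : V → V → Set
    ~-sym   : ∀ {x y} → x ~ y → y ~ x
    ~-irrefl : ∀ {x} → ¬ (x ~ x)

open Graph public

IsRegular : Graph → ℕ → Set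
IsRegular Γ d = ∀ (x : V Γ) → Σ (Fin d → V Γ) λ nb →
    (∀ i j → nb i ≡ nb j → i ≡ j)
  × (∀ i → _~_ Γ x (nb i))
  × (∀ y → _~_ Γ x y → ∃[ i ] nb i ≡ y)

InBall₁ : (Γ : Graph) → V Γ → V Γ → Set
InBall₁ Γ x u = u ≡ x ⊎ _~_ Γ x u

-- Conditions (i)–(iii) on maps η₁ … η_d : B₁(x) → V.  The maps are given
-- as total functions V → V, of which only the restriction to B₁(x) is
-- constrained (equivalent to maps defined on B₁(x)).
IsRicciFlatMaps : (Γ : Graph) (d : ℕ) (x : V Γ) (η : Fin d → V Γ → V Γ) → Set
IsRicciFlatMaps Γ d x η =
    (∀ i u → InBall₁ Γ x u → _~_ Γ (η i u) u)
  × (∀ i j u → InBall₁ Γ x u → i ≢ j → η i u ≢ η j u)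
  × (∀ i (v : V Γ) → (∃[ j ] η j (η i x) ≡ v) ⇔ (∃[ j ] η i (η j x) ≡ v))

data Kind : Set where
  plain R S RS : Kind

ExtraCond : Kind → (Γ : Graph) (d : ℕ) (x : V Γ) (η : Fin d → V Γ → V Γ) → Set
ExtraCond plain Γ d x η = ⊤
ExtraCond R  Γ d x η = ∀ i → η i (η i x) ≡ x
ExtraCond S  Γ d x η = ∀ i j → η j (η i x) ≡ η i (η j x)
ExtraCond RS Γ d x η = (∀ i → η i (η i x) ≡ x) × (∀ i j → η j (η i x) ≡ η i (η j x))

RicciFlatAt : Kind → (Γ : Graph) (d : ℕ) → V Γ → Set
RicciFlatAt k Γ d x = Σ (Fin d → V Γ → V Γ) λ η →
  IsRicciFlatMaps Γ d x η × ExtraCond k Γ d x η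

RicciFlat : Kind → (Γ : Graph) (d : ℕ) → Set
RicciFlat k Γ d = ∀ (x : V Γ) → RicciFlatAt k Γ d x

-- Products: G ⊗ H tensor, G □ H Cartesian (paper's G × H), G ⊠ H strong

_⊗_ : Graph → Graph → Graph
G ⊗ H = record
  { V = V G × V H
  ; _~_ = λ { (x₁ , y₁) (x₂ , y₂) → _~_ G x₁ x₂ × _~_ H y₁ y₂ }
  ; ~-sym = λ { (p , q) → ~-sym G p , ~-sym H q }
  ; ~-irrefl = λ { (p , _) → ~-irrefl G p }
  }

_□_ : Graph → Graph → Graph
G □ H = record
  { V = V G × V H
  ; _~_ = λ { (x₁ , y₁) (x₂ , y₂) →
        (_~_ G x₁ x₂ × y₁ ≡ y₂) ⊎ (x₁ ≡ x₂ × _~_ H y₁ y₂) }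
  ; ~-sym = λ { (inj₁ (p , e)) → inj₁ (~-sym G p , sym e)
              ; (inj₂ (e , q)) → inj₂ (sym e , ~-sym H q) }
  ; ~-irrefl = λ { (inj₁ (p , _)) → ~-irrefl G p
                 ; (inj₂ (_ , q)) → ~-irrefl H q }
  }

_⊠_ : Graph → Graph → Graph
G ⊠ H = record
  { V = V G × V H
  ; _~_ = λ { (x₁ , y₁) (x₂ , y₂) →
        (_~_ G x₁ x₂ × y₁ ≡ y₂) ⊎ (x₁ ≡ x₂ × _~_ H y₁ y₂)
          ⊎ (_~_ G x₁ x₂ × _~_ H y₁ y₂) }
  ; ~-sym = λ { (inj₁ (p , e)) → inj₁ (~-sym G p , sym e)
              ; (inj₂ (inj₁ (e , q))) → inj₂ (inj₁ (sym e , ~-sym H q))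
              ; (inj₂ (inj₂ (p , q))) → inj₂ (inj₂ (~-sym G p , ~-sym H q)) }
  ; ~-irrefl = λ { (inj₁ (p , _)) → ~-irrefl G p
                 ; (inj₂ (inj₁ (_ , q))) → ~-irrefl H q
                 ; (inj₂ (inj₂ (p , _))) → ~-irrefl G p }
  }

module Submission where

-- Every edge of a product of G and H moves each coordinate by at most one
-- step.  So we extend a Ricci-flat family η of G at x to "optional moves"
-- Maybe I: 'nothing' stays, 'just i' moves by η i.  The extended family
-- keeps conditions (ii), (iii), (R) and (S), with witnesses in (iii) of the
-- same kind (move or stay) as the given index.  A product family acts by a
-- pair of optional moves; which pairs occur is fixed by a "move pattern"
-- that is closed under changing moves while keeping their shape (which
-- coordinates move).  Tensor, Cartesian and strong products use the
-- diagonal, horizontal ⊎ vertical, and all three patterns respectively; each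
-- pattern move is an edge of the product, so the product family is Ricci
-- flat, and the theorem follows by enumerating each pattern by Fin n.

open import Defs
open import Data.Bool using (Bool; true; false)
open import Data.Empty using (⊥-elim)
open import Data.Fin using (Fin; _≟_)
open import Data.Fin.Properties using (+↔⊎; *↔×)
open import Data.Maybe using (Maybe; just; nothing; is-just)
open import Data.Maybe.Properties using (just-injective)
open import Data.Nat using (ℕ; _+_; _*_)
open import Data.Product using (_×_; _,_; proj₁; proj₂; ∃-syntax)
open import Data.Product.Properties using (×-≡,≡→≡)
open import Data.Sum using (_⊎_; inj₁; inj₂)
open import Data.Sum.Function.Propositional using (_⊎-↔_)
open import Data.Unit using (tt)
open import Function.Bundles using (_⇔_; mk⇔; Equivalence; _↔_; Inverse)
open import Function.Properties.Inverse using (↔-trans)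
open import Relation.Binary.Definitions using (DecidableEquality)
open import Relation.Binary.PropositionalEquality
open import Relation.Nullary using (¬_)
open import Relation.Nullary.Decidable using (decidable-stable)

IsFlatFamily : (Γ : Graph) (x : V Γ) {I : Set} (η : I → V Γ → V Γ) → Set
IsFlatFamily Γ x η =
    (∀ i u → InBall₁ Γ x u → _~_ Γ (η i u) u)
  × (∀ i j u → InBall₁ Γ x u → i ≢ j → η i u ≢ η j u)
  × (∀ i (v : V Γ) → (∃[ j ] η j (η i x) ≡ v) ⇔ (∃[ j ] η i (η j x) ≡ v))

Involutive : (Γ : Graph) (x : V Γ) {I : Set} (η : I → V Γ → V Γ) → Set
Involutive Γ x η = ∀ i → η i (η i x) ≡ x

Commuting : (Γ : Graph) (x : V Γ) {I : Set} (η : I → V Γ → V Γ) → Set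
Commuting Γ x η = ∀ i j → η j (η i x) ≡ η i (η j x)

act : {I A : Set} → (I → A → A) → Maybe I → A → A
act η nothing  u = u
act η (just i) u = η i u

Step : (Γ : Graph) → Bool → V Γ → V Γ → Set
Step Γ false u′ u = u′ ≡ u
Step Γ true  u′ u = _~_ Γ u′ u

module OptionalMoves (Γ : Graph) {I : Set} (_≟ᵢ_ : DecidableEquality I)
  {x : V Γ} {η : I → V Γ → V Γ} where

  act-step : (∀ i u → InBall₁ Γ x u → _~_ Γ (η i u) u)
    → ∀ m {u} → InBall₁ Γ x u → Step Γ (is-just m) (act η m u) u
  act-step adjacent nothing  b = refl
  act-step adjacent (just i) b = adjacent i _ b

  -- Distinct optional moves send a vertex of B₁(x) to distinct vertices:
  -- a move never stays (irreflexivity), two moves differ by (ii).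
  act-injective : IsFlatFamily Γ x η
    → ∀ m m′ {u} → InBall₁ Γ x u → act η m u ≡ act η m′ u → m ≡ m′
  act-injective flat nothing  nothing  b e = refl
  act-injective flat nothing  (just j) b e =
    ⊥-elim (~-irrefl Γ (subst (λ w → _~_ Γ w _) (sym e) (proj₁ flat j _ b)))
  act-injective flat (just i) nothing  b e =
    ⊥-elim (~-irrefl Γ (subst (λ w → _~_ Γ w _) e (proj₁ flat i _ b)))
  act-injective flat (just i) (just j) b e =
    cong just (decidable-stable (i ≟ᵢ j) (λ i≢j → proj₁ (proj₂ flat) i j _ b i≢j e))

  act-commute : IsFlatFamily Γ x η → ∀ m n
    → ∃[ n′ ] is-just n′ ≡ is-just n × act η m (act η n′ x) ≡ act η n (act η m x)
  act-commute flat nothing  n        = n , refl , refl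
  act-commute flat (just i) nothing  = nothing , refl , refl
  act-commute flat (just i) (just j) =
    let j′ , e = Equivalence.to (proj₂ (proj₂ flat) i _) (j , refl)
    in just j′ , refl , e

  act-commute⁻¹ : IsFlatFamily Γ x η → ∀ m n
    → ∃[ n′ ] is-just n′ ≡ is-just n × act η n′ (act η m x) ≡ act η m (act η n x)
  act-commute⁻¹ flat nothing  n        = n , refl , refl
  act-commute⁻¹ flat (just i) nothing  = nothing , refl , refl
  act-commute⁻¹ flat (just i) (just j) =
    let j′ , e = Equivalence.from (proj₂ (proj₂ flat) i _) (j , refl)
    in just j′ , refl , e

  act-involutive : Involutive Γ x η → ∀ m → act η m (act η m x) ≡ x
  act-involutive inv nothing  = refl
  act-involutive inv (just i) = inv i

  act-commuting : Commuting Γ x η → ∀ m n → act η n (act η m x) ≡ act η m (act η n x)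
  act-commuting comm nothing  n        = refl
  act-commuting comm (just i) nothing  = refl
  act-commuting comm (just i) (just j) = comm i j

shape : {A B : Set} → Maybe A × Maybe B → Bool × Bool
shape p = is-just (proj₁ p) , is-just (proj₂ p)

record MovePattern (J A B : Set) : Set where
  field
    move           : J → Maybe A × Maybe B
    move-injective : ∀ {a c} → move a ≡ move c → a ≡ c
    move-closed    : ∀ a p → shape p ≡ shape (move a) → ∃[ a′ ] move a′ ≡ p

open MovePattern

horizontal : {A B : Set} → MovePattern A A B
horizontal = record
  { move           = λ i → just i , nothing
  ; move-injective = λ e → just-injective (cong proj₁ e)
  ; move-closed    = closed
  }
  where
  closed : ∀ {A B} (i : A) (p : Maybe A × Maybe B)
    → shape p ≡ (true , false) → ∃[ i′ ] (just i′ , nothing) ≡ p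
  closed i (just k , nothing) refl = k , refl
  closed i (nothing , _)      ()
  closed i (just k , just l)  ()

vertical : {A B : Set} → MovePattern B A B
vertical = record
  { move           = λ j → nothing , just j
  ; move-injective = λ e → just-injective (cong proj₂ e)
  ; move-closed    = closed
  }
  where
  closed : ∀ {A B} (j : B) (p : Maybe A × Maybe B)
    → shape p ≡ (false , true) → ∃[ j′ ] (nothing , just j′) ≡ p
  closed j (nothing , just l) refl = l , refl
  closed j (just _ , _)       ()
  closed j (nothing , nothing) ()

diagonal : {A B : Set} → MovePattern (A × B) A B
diagonal = record
  { move           = λ ij → just (proj₁ ij) , just (proj₂ ij)
  ; move-injective = λ e → ×-≡,≡→≡ (just-injective (cong proj₁ e) , just-injective (cong proj₂ e))
  ; move-closed    = closed
  }
  where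
  closed : ∀ {A B} (ij : A × B) (p : Maybe A × Maybe B)
    → shape p ≡ (true , true) → ∃[ kl ] (just (proj₁ kl) , just (proj₂ kl)) ≡ p
  closed ij (just k , just l) refl = (k , l) , refl
  closed ij (nothing , _)     ()
  closed ij (just _ , nothing) ()

union : ∀ {J₁ J₂ A B} (P₁ : MovePattern J₁ A B) (P₂ : MovePattern J₂ A B)
  → (∀ a c → shape (move P₁ a) ≢ shape (move P₂ c))
  → MovePattern (J₁ ⊎ J₂) A B
union {J₁} {J₂} {A} {B} P₁ P₂ disjoint = record
  { move           = move₁₂
  ; move-injective = injective
  ; move-closed    = closed
  }
  where
  move₁₂ : J₁ ⊎ J₂ → Maybe A × Maybe B
  move₁₂ (inj₁ a) = move P₁ a
  move₁₂ (inj₂ c) = move P₂ c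

  injective : ∀ {a c} → move₁₂ a ≡ move₁₂ c → a ≡ c
  injective {inj₁ a} {inj₁ c} e = cong inj₁ (move-injective P₁ e)
  injective {inj₁ a} {inj₂ c} e = ⊥-elim (disjoint a c (cong shape e))
  injective {inj₂ a} {inj₁ c} e = ⊥-elim (disjoint c a (cong shape (sym e)))
  injective {inj₂ a} {inj₂ c} e = cong inj₂ (move-injective P₂ e)

  closed : ∀ a p → shape p ≡ shape (move₁₂ a) → ∃[ a′ ] move₁₂ a′ ≡ p
  closed (inj₁ a) p s = let a′ , e = move-closed P₁ a p s in inj₁ a′ , e
  closed (inj₂ c) p s = let c′ , e = move-closed P₂ c p s in inj₂ c′ , e

cartesian : {A B : Set} → MovePattern (A ⊎ B) A B
cartesian = union horizontal vertical (λ _ _ ())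

strong : {A B : Set} → MovePattern ((A ⊎ B) ⊎ (A × B)) A B
strong = union cartesian diagonal λ { (inj₁ _) _ () ; (inj₂ _) _ () }

reindex : ∀ {J′ J A B} → J′ ↔ J → MovePattern J A B → MovePattern J′ A B
reindex e P = record
  { move           = λ a → move P (to a)
  ; move-injective = λ m≡m → trans (sym (strictlyInverseʳ _))
                       (trans (cong from (move-injective P m≡m)) (strictlyInverseʳ _))
  ; move-closed    = λ a p s → let a′ , m≡p = move-closed P (to a) p s
                               in from a′ , trans (cong (move P) (strictlyInverseˡ a′)) m≡p
  }
  where open Inverse e

extra-product : ∀ k {Γ₁ Γ₂ Γ : Graph} {d₁ d₂ d x₁ x₂ x}
  {η₁ : Fin d₁ → V Γ₁ → V Γ₁} {η₂ : Fin d₂ → V Γ₂ → V Γ₂} {η : Fin d → V Γ → V Γ}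
  → (Involutive Γ₁ x₁ η₁ → Involutive Γ₂ x₂ η₂ → Involutive Γ x η)
  → (Commuting Γ₁ x₁ η₁ → Commuting Γ₂ x₂ η₂ → Commuting Γ x η)
  → ExtraCond k Γ₁ d₁ x₁ η₁ → ExtraCond k Γ₂ d₂ x₂ η₂ → ExtraCond k Γ d x η
extra-product plain inv comm _ _ = tt
extra-product R  inv comm i₁ i₂ = inv i₁ i₂
extra-product S  inv comm c₁ c₂ = comm c₁ c₂
extra-product RS inv comm (i₁ , c₁) (i₂ , c₂) = inv i₁ i₂ , comm c₁ c₂

EdgeShape : (G H : Graph) → (V G × V H → V G × V H → Set) → Bool × Bool → Set
EdgeShape G H _≈_ s =
  ∀ {u u′ v v′} → Step G (proj₁ s) u′ u → Step H (proj₂ s) v′ v → (u′ , v′) ≈ (u , v)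

module Product (G H : Graph) (_≈_ : V G × V H → V G × V H → Set)
  (≈-sym : ∀ {p q} → p ≈ q → q ≈ p) (≈-irrefl : ∀ {p} → ¬ p ≈ p)
  (coordinate-steps : ∀ {x y u v} → (x , y) ≈ (u , v) → InBall₁ G x u × InBall₁ H y v)
  where

  P : Graph
  P = record { V = V G × V H ; _~_ = _≈_ ; ~-sym = ≈-sym ; ~-irrefl = ≈-irrefl }

  ball-projection : ∀ {x y u v} → InBall₁ P (x , y) (u , v) → InBall₁ G x u × InBall₁ H y v
  ball-projection (inj₁ refl) = inj₁ refl , inj₁ refl
  ball-projection (inj₂ e)    = coordinate-steps e

  module Family {IG IH J : Set} (_≟G_ : DecidableEquality IG) (_≟H_ : DecidableEquality IH)
    {x : V G} {y : V H} {ηG : IG → V G → V G} {ηH : IH → V H → V H}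
    (pat : MovePattern J IG IH) (edges : ∀ a → EdgeShape G H _≈_ (shape (move pat a)))
    where

    open OptionalMoves G _≟G_ {x} {ηG} renaming
      (act-step to stepG; act-injective to injectiveG; act-commute to commuteG;
       act-commute⁻¹ to commute⁻¹G; act-involutive to involutiveG; act-commuting to commutingG)
    open OptionalMoves H _≟H_ {y} {ηH} renaming
      (act-step to stepH; act-injective to injectiveH; act-commute to commuteH;
       act-commute⁻¹ to commute⁻¹H; act-involutive to involutiveH; act-commuting to commutingH)

    actPair : Maybe IG × Maybe IH → V P → V P
    actPair (m , n) (u , v) = act ηG m u , act ηH n v

    η : J → V P → V P
    η a = actPair (move pat a)

    pair-commute : IsFlatFamily G x ηG → IsFlatFamily H y ηH → ∀ p q
      → ∃[ q′ ] shape q′ ≡ shape q × actPair p (actPair q′ (x , y)) ≡ actPair q (actPair p (x , y))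
    pair-commute flatG flatH (m , n) (m′ , n′) =
      let k , sk , ek = commuteG flatG m m′ ; l , sl , el = commuteH flatH n n′
      in (k , l) , cong₂ _,_ sk sl , cong₂ _,_ ek el

    pair-commute⁻¹ : IsFlatFamily G x ηG → IsFlatFamily H y ηH → ∀ p q
      → ∃[ q′ ] shape q′ ≡ shape q × actPair q′ (actPair p (x , y)) ≡ actPair p (actPair q (x , y))
    pair-commute⁻¹ flatG flatH (m , n) (m′ , n′) =
      let k , sk , ek = commute⁻¹G flatG m m′ ; l , sl , el = commute⁻¹H flatH n n′
      in (k , l) , cong₂ _,_ sk sl , cong₂ _,_ ek el

    flat : IsFlatFamily G x ηG → IsFlatFamily H y ηH → IsFlatFamily P (x , y) η
    flat flatG flatH = adjacent , distinct , λ a w → mk⇔ (forward a w) (backward a w)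
      where
      adjacent : ∀ a p → InBall₁ P (x , y) p → η a p ≈ p
      adjacent a (u , v) b = let bu , bv = ball-projection b in
        edges a (stepG (proj₁ flatG) (proj₁ (move pat a)) bu)
                (stepH (proj₁ flatH) (proj₂ (move pat a)) bv)

      distinct : ∀ a c p → InBall₁ P (x , y) p → a ≢ c → η a p ≢ η c p
      distinct a c (u , v) b a≢c e = let bu , bv = ball-projection b in
        a≢c (move-injective pat (×-≡,≡→≡
          ( injectiveG flatG (proj₁ (move pat a)) (proj₁ (move pat c)) bu (cong proj₁ e)
          , injectiveH flatH (proj₂ (move pat a)) (proj₂ (move pat c)) bv (cong proj₂ e))))

      forward : ∀ a w → (∃[ c ] η c (η a (x , y)) ≡ w) → (∃[ c ] η a (η c (x , y)) ≡ w)
      forward a w (c , e) =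
        let q′ , s , commutes = pair-commute flatG flatH (move pat a) (move pat c)
            c′ , c′↦q′ = move-closed pat c q′ s
        in c′ , (begin
          actPair (move pat a) (actPair (move pat c′) (x , y))
            ≡⟨ cong (λ q → actPair (move pat a) (actPair q (x , y))) c′↦q′ ⟩
          actPair (move pat a) (actPair q′ (x , y))  ≡⟨ commutes ⟩
          η c (η a (x , y))                          ≡⟨ e ⟩
          w                                          ∎)
        where open ≡-Reasoning

      backward : ∀ a w → (∃[ c ] η a (η c (x , y)) ≡ w) → (∃[ c ] η c (η a (x , y)) ≡ w)
      backward a w (c , e) =
        let q′ , s , commutes = pair-commute⁻¹ flatG flatH (move pat a) (move pat c)
            c′ , c′↦q′ = move-closed pat c q′ s
        in c′ , (begin
          actPair (move pat c′) (actPair (move pat a) (x , y))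
            ≡⟨ cong (λ q → actPair q (actPair (move pat a) (x , y))) c′↦q′ ⟩
          actPair q′ (actPair (move pat a) (x , y))  ≡⟨ commutes ⟩
          η a (η c (x , y))                          ≡⟨ e ⟩
          w                                          ∎)
        where open ≡-Reasoning

    involutive : Involutive G x ηG → Involutive H y ηH → Involutive P (x , y) η
    involutive invG invH a =
      cong₂ _,_ (involutiveG invG (proj₁ (move pat a))) (involutiveH invH (proj₂ (move pat a)))

    commuting : Commuting G x ηG → Commuting H y ηH → Commuting P (x , y) η
    commuting commG commH a c =
      cong₂ _,_ (commutingG commG (proj₁ (move pat a)) (proj₁ (move pat c)))
                (commutingH commH (proj₂ (move pat a)) (proj₂ (move pat c)))

  product-flat : ∀ k {dG dH n J} (enumeration : Fin n ↔ J)
    (pat : MovePattern J (Fin dG) (Fin dH)) → (∀ a → EdgeShape G H _≈_ (shape (move pat a)))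
    → RicciFlat k G dG → RicciFlat k H dH → RicciFlat k P n
  product-flat k enumeration pat edges flatG flatH (x , y) =
    let ηG , mapsG , extraG = flatG x ; ηH , mapsH , extraH = flatH y
        open Family _≟_ _≟_ {x} {y} {ηG} {ηH} (reindex enumeration pat)
                    (λ a → edges (Inverse.to enumeration a))
    in η , flat mapsG mapsH , extra-product k involutive commuting extraG extraH

module Tensor (G H : Graph) where
  steps : ∀ {x y u v} → _~_ (G ⊗ H) (x , y) (u , v) → InBall₁ G x u × InBall₁ H y v
  steps (p , q) = inj₂ p , inj₂ q

  edges : ∀ {A B} (a : A × B) → EdgeShape G H (_~_ (G ⊗ H)) (shape (move diagonal a))
  edges a p q = p , q

  open Product G H (_~_ (G ⊗ H)) (~-sym (G ⊗ H)) (~-irrefl (G ⊗ H)) steps public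

module Cartesian (G H : Graph) where
  steps : ∀ {x y u v} → _~_ (G □ H) (x , y) (u , v) → InBall₁ G x u × InBall₁ H y v
  steps (inj₁ (p , e)) = inj₂ p , inj₁ (sym e)
  steps (inj₂ (e , q)) = inj₁ (sym e) , inj₂ q

  edges : ∀ {A B} (a : A ⊎ B) → EdgeShape G H (_~_ (G □ H)) (shape (move cartesian a))
  edges (inj₁ _) p e = inj₁ (p , e)
  edges (inj₂ _) e q = inj₂ (e , q)

  open Product G H (_~_ (G □ H)) (~-sym (G □ H)) (~-irrefl (G □ H)) steps public

module Strong (G H : Graph) where
  steps : ∀ {x y u v} → _~_ (G ⊠ H) (x , y) (u , v) → InBall₁ G x u × InBall₁ H y v
  steps (inj₁ (p , e))        = inj₂ p , inj₁ (sym e)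
  steps (inj₂ (inj₁ (e , q))) = inj₁ (sym e) , inj₂ q
  steps (inj₂ (inj₂ (p , q))) = inj₂ p , inj₂ q

  edges : ∀ {A B} (a : (A ⊎ B) ⊎ (A × B)) → EdgeShape G H (_~_ (G ⊠ H)) (shape (move strong a))
  edges (inj₁ (inj₁ _)) p e = inj₁ (p , e)
  edges (inj₁ (inj₂ _)) e q = inj₂ (inj₁ (e , q))
  edges (inj₂ _)        p q = inj₂ (inj₂ (p , q))

  open Product G H (_~_ (G ⊠ H)) (~-sym (G ⊠ H)) (~-irrefl (G ⊠ H)) steps public

-- Regularity only fixes the degrees d_G, d_H; the maps are built from the
-- given ones via the patterns, enumerated by Fin (d_G d_H), Fin (d_G + d_H)
-- and Fin (d_G + d_H + d_G d_H).
theorem5p2 : (k : Kind) (G H : Graph) (dG dH : ℕ)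
    → IsRegular G dG → IsRegular H dH
    → RicciFlat k G dG → RicciFlat k H dH
    → RicciFlat k (G ⊗ H) (dG * dH)
      × RicciFlat k (G □ H) (dG + dH)
      × RicciFlat k (G ⊠ H) (dG + dH + dG * dH)
theorem5p2 k G H dG dH _ _ flatG flatH =
    ⊗.product-flat k *↔× diagonal ⊗.edges flatG flatH
  , □.product-flat k +↔⊎ cartesian □.edges flatG flatH
  , ⊠.product-flat k (↔-trans +↔⊎ (+↔⊎ ⊎-↔ *↔×)) strong ⊠.edges flatG flatH
  where
  module ⊗ = Tensor G H
  module □ = Cartesian G H
  module ⊠ = Strong G H
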